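{- Let $G$ be a finite simple undirected graph. The map $\psi:\mathcal{C}^{\mathrm{Cube}}_n(G)\to\mathcal{C}^{\mathrm{Path}}_n(G)$ is an isomorphism for $n\le1$ and is surjective for $n=2$.
   Context: $R$ is a commutative ring with unit. A graph homomorphism is a vertex map sending adjacent vertices to equal or adjacent vertices. $Q_n$ is the graph on $\{0,1\}^n$ with Hamming-distance-one edges ($Q_0$ a single vertex); a singular $n$-cube on $G$ is a graph homomorphism $\sigma: Q_n\to G$. For $n\ge1$, $i\in[n]$: $f_i^{\pm}\sigma(a_1,\dots,a_{n-1})=\sigma(a_1,\dots,a_{i-1},\epsilon,a_i,\dots,a_{n-1})$, $\epsilon=1$ for $+$, $0$ for $-$; $\sigma$ is degenerate if $f_i^+\sigma=f_i^-\sigma$ for some $i$ ($0$-cubes are non-degenerate). $\mathcal{C}^{\mathrm{Cube}}_n(G)$ is the free $R$-module on singular $n$-cubes modulo the span of degenerate ones. Path complex: for $V=V(G)$, $\mathcal{C}_n(V)$ is the free $R$-module on $(n+1)$-tuples of vertices modulo the span of tuples with $v_i=v_{i+1}$ for some $i$; $\partial_n(v_0,\dots,v_n)=\sum_{i=0}^n(-1)^i(v_0,\dots,\widehat{v_i},\dots,v_n)$, $\partial_0=0$. $\widetilde{\mathcal{C}}_n(G)$ is generated by allowed paths (tuples with $\{v_i,v_{i+1}\}\in E(G)$ for all $i$), $\widetilde{\mathcal{C}}_{ -1}=0$; $\mathcal{C}^{\mathrm{Path}}_n(G)=\{x\in\widetilde{\mathcal{C}}_n(G):\partial_nx\in\widetilde{\mathcal{C}}_{n-1}(G)\}$.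 The map $\psi$: for $\tau\in S_n$, $p_\tau$ is the path $p_\tau(0),\dots,p_\tau(n)$ in $Q_n$ from $(0,\dots,0)$ whose $i$-th step flips coordinate $\tau(i)$ from $0$ to $1$; $\psi(\sigma)=\sum_{\tau\in S_n}\mathrm{sign}(\tau)\,(\sigma(p_\tau(0)),\dots,\sigma(p_\tau(n)))$, extended linearly. It vanishes on degenerate cubes and takes values in $\mathcal{C}^{\mathrm{Path}}_n(G)$, hence induces $\psi:\mathcal{C}^{\mathrm{Cube}}_n(G)\to\mathcal{C}^{\mathrm{Path}}_n(G)$. -}

module Defs where

open import Level using (Level; _⊔_)
open import Algebra.Bundles using (CommutativeRing)
open import Data.Bool using (Bool; true; false; not; if_then_else_)
open import Data.Nat using (ℕ; zero; suc; _<ᵇ_; _≡ᵇ_)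
open import Data.Fin using (Fin; toℕ; inject₁) renaming (zero to fzero; suc to fsuc)
open import Data.Fin.Properties using () renaming (_≟_ to _≟F_)
open import Data.Vec using (Vec; []; _∷_; lookup; tabulate; insertAt; removeAt; toList)
open import Data.Vec.Properties using (≡-dec)
open import Data.List using (List; []; _∷_; map; concatMap; allFin; filterᵇ; take; length; foldr; _++_)
open import Data.Bool.ListAction using (all; any)
open import Data.List.Relation.Unary.All using (All)
open import Data.Product using (Σ; ∃; _×_; _,_; proj₁; proj₂)
open import Data.Sum using (_⊎_)
open import Data.Empty using (⊥)
open import Relation.Binary.PropositionalEquality using (_≡_)
open import Relation.Nullary.Decidable using (⌊_⌋)

record Graph : Set where
  field
    m      : ℕ
    E      : Fin m → Fin m → Bool
    E-sym  : ∀ x y → E x y ≡ E y x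
    E-irr  : ∀ x → E x x ≡ false

-- Hamming distance one on {0,1}^n (vertices of Q_n are Vec Bool n).

HD1 : ∀ {n} → Vec Bool n → Vec Bool n → Set
HD1 []      []      = ⊥
HD1 (a ∷ u) (b ∷ v) = (a ≡ b × HD1 u v) ⊎ ((a ≡ b → ⊥) × u ≡ v)

allBoolVecs : (n : ℕ) → List (Vec Bool n)
allBoolVecs zero    = [] ∷ []
allBoolVecs (suc n) = concatMap (λ b → map (b ∷_) (allBoolVecs n)) (true ∷ false ∷ [])

allFinVecs : (n k : ℕ) → List (Vec (Fin n) k)
allFinVecs n zero    = [] ∷ []
allFinVecs n (suc k) = concatMap (λ i → map (i ∷_) (allFinVecs n k)) (allFin n)

-- Permutations of [n] as vectors τ = (τ(1),…,τ(n)) (0-based Fin n),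
-- sign = (-1)^(number of inversions).

notInℕ : ℕ → List ℕ → Bool
notInℕ x xs = not (any (λ y → x ≡ᵇ y) xs)

distinct : List ℕ → Bool
distinct []       = true
distinct (x ∷ xs) = if notInℕ x xs then distinct xs else false

inversions : List ℕ → ℕ
inversions []       = 0
inversions (x ∷ xs) = length (filterᵇ (λ y → y <ᵇ x) xs) Data.Nat.+ inversions xs

permutations : (n : ℕ) → List (Vec (Fin n) n)
permutations n = filterᵇ (λ τ → distinct (map toℕ (toList τ))) (allFinVecs n n)

pathVertex : ∀ {n} → Vec (Fin n) n → ℕ → Vec Bool n
pathVertex {n} τ j = tabulate (λ c → any (λ d → ⌊ d ≟F c ⌋) (take j (toList τ)))

module Chains {c ℓ : Level} (R : CommutativeRing c ℓ) (G : Graph) where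
  open CommutativeRing R using (Carrier; _≈_; _+_; _*_; -_; 0#; 1#)
  open Graph G

  V : Set
  V = Fin m

  Adj : V → V → Set
  Adj x y = E x y ≡ true

  -- free R-module on a set X with decidable identity of generators,
  -- represented by finite formal sums; equality = equal coefficients
  FS : Set → Set c
  FS X = List (Carrier × X)

  coeff : {X : Set} → (X → X → Bool) → FS X → X → Carrier
  coeff eq xs x = foldr (λ p acc → if eq (proj₂ p) x then proj₁ p + acc else acc) 0# xs

  _≈F[_]_ : {X : Set} → FS X → (X → X → Bool) → FS X → Set ℓ
  xs ≈F[ eq ] ys = ∀ x → coeff eq xs x ≈ coeff eq ys x

  -- equality in the quotient of the free module by the span of the
  -- generators satisfying D: x - y lies in the span of D-generators
  QuotEq : {X : Set} → (X → X → Bool) → (X → Set) → FS X → FS X → Set (c ⊔ ℓ)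
  QuotEq eq D x y = Σ (FS _) λ d → All (λ p → D (proj₂ p)) d × (x ≈F[ eq ] (y ++ d))

  alt : ℕ → Carrier → Carrier
  alt zero    r = r
  alt (suc i) r = - alt i r

  record Cube (n : ℕ) : Set where
    field
      fun : Vec Bool n → V
      hom : ∀ u v → HD1 u v → fun u ≡ fun v ⊎ Adj (fun u) (fun v)
  open Cube public

  eqCube : ∀ {n} → Cube n → Cube n → Bool
  eqCube {n} σ τ = all (λ u → ⌊ fun σ u ≟F fun τ u ⌋) (allBoolVecs n)

  DegenerateCube : ∀ {n} → Cube n → Set
  DegenerateCube {zero}  σ = ⊥
  DegenerateCube {suc k} σ =
    Σ (Fin (suc k)) λ i → ∀ (a : Vec Bool k) → fun σ (insertAt a i true) ≡ fun σ (insertAt a i false)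

  CCube : ℕ → Set c
  CCube n = FS (Cube n)

  _~C_ : ∀ {n} → CCube n → CCube n → Set (c ⊔ ℓ)
  _~C_ = QuotEq eqCube DegenerateCube

  Tup : ℕ → Set
  Tup n = Vec V (suc n)

  eqTup : ∀ {n} → Tup n → Tup n → Bool
  eqTup s t = ⌊ ≡-dec _≟F_ s t ⌋

  DegenerateTup : ∀ {n} → Tup n → Set
  DegenerateTup {n} v = Σ (Fin n) λ i → lookup v (inject₁ i) ≡ lookup v (fsuc i)

  Allowed : ∀ {n} → Tup n → Set
  Allowed {n} v = ∀ (i : Fin n) → Adj (lookup v (inject₁ i)) (lookup v (fsuc i))

  CV : ℕ → Set c
  CV n = FS (Tup n)

  _~P_ : ∀ {n} → CV n → CV n → Set (c ⊔ ℓ)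
  _~P_ = QuotEq eqTup DegenerateTup

  ∂gen : ∀ {n} → Tup (suc n) → CV n
  ∂gen {n} v = map (λ i → alt (toℕ i) 1# , removeAt v i) (Data.List.allFin (suc (suc n)))

  ∂ : ∀ {n} → CV (suc n) → CV n
  ∂ = concatMap (λ p → map (λ q → proj₁ p * proj₁ q , proj₂ q) (∂gen (proj₂ p)))

  InTilde : ∀ n → CV n → Set (c ⊔ ℓ)
  InTilde n x = Σ (CV n) λ a → All (λ p → Allowed (proj₂ p)) a × (x ~P a)

  -- x ∈ C^Path_n(G)  (∂_0 = 0 ∈ C̃_{-1} = 0, so no condition for n = 0)
  InCPath : ∀ n → CV n → Set (c ⊔ ℓ)
  InCPath zero    x = InTilde zero x
  InCPath (suc k) x = InTilde (suc k) x × InTilde k (∂ x)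

  ψgen : ∀ {n} → Cube n → CV n
  ψgen {n} σ =
    map (λ τ → alt (inversions (map toℕ (toList τ))) 1#
             , tabulate (λ (j : Fin (suc n)) → fun σ (pathVertex τ (toℕ j))))
        (permutations n)

  ψ : ∀ {n} → CCube n → CV n
  ψ = concatMap (λ p → map (λ q → proj₁ p * proj₁ q , proj₂ q) (ψgen (proj₂ p)))

  -- ψ is linear by construction; these say it is well defined on the
  -- quotients and lands in C^Path_n(G)
  WellDefined : ℕ → Set (c ⊔ ℓ)
  WellDefined n = (∀ (x y : CCube n) → x ~C y → ψ x ~P ψ y)
                × (∀ (x : CCube n) → InCPath n (ψ x))

  Injective : ℕ → Set (c ⊔ ℓ)
  Injective n = ∀ (x y : CCube n) → ψ x ~P ψ y → x ~C y

  Surjective : ℕ → Set (c ⊔ ℓ)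
  Surjective n = ∀ (y : CV n) → InCPath n y → Σ (CCube n) λ x → ψ x ~P y

  IsIsomorphism : ℕ → Set (c ⊔ ℓ)
  IsIsomorphism n = WellDefined n × Injective n × Surjective n

-- In dimensions 0 and 1 a cube is determined by its tuple of corners, which is an arbitrary
-- vertex, resp. a pair of equal or adjacent vertices, and ψ merely relabels every cube by
-- that tuple. Degenerate cubes correspond to degenerate tuples, so ψ is an isomorphism there.
--
-- In dimension 2, an allowed path (u, v, w) is ψ of the square with sides u → v → w and
-- u → x → w, up to the shortcut (u, x, w), where x is u if u and w are equal or adjacent and a
-- common neighbour of u and w otherwise. Shortcuts with near ends are degenerate. If
-- y = a + d lies in C^Path_2 with a allowed and d degenerate, the shortcuts of a with far ends
-- u, w carry in total minus the coefficient of (u, w) in ∂a, which vanishes because ∂y lies in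
-- C̃_1 and ∂d has no mass on far pairs. To compare boundaries of chains with equal
-- coefficients, the coefficient of w in ∂z is written as the pairing of z with the finite list
-- of tuples having w as a face.

module Submission where

open import Defs
open import Level using (Level)
open import Algebra.Bundles using (CommutativeRing)
import Algebra.Properties.CommutativeSemigroup as CommutativeSemigroupProperties
import Algebra.Properties.Ring as RingProperties
open import Data.Bool as Bool using (Bool; true; false; _∧_; if_then_else_)
open import Data.Empty using (⊥-elim)
open import Data.Fin using (Fin; toℕ; inject₁) renaming (zero to fzero; suc to fsuc)
open import Data.Fin.Properties using (any?; all?) renaming (_≟_ to _≟F_)
open import Data.List using ([]; _∷_; map; concatMap; foldr; _++_; filter; tabulate; allFin)
open import Data.List.Properties using (map-++; map-∘)
open import Data.List.Relation.Unary.All as All using (All; []; _∷_)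
open import Data.List.Relation.Unary.All.Properties using (map⁺; ++⁺; all-filter; filter⁺; tabulate⁺)
open import Data.Nat using (ℕ; zero; suc; _≤_; s≤s)
open import Data.Product using (Σ; _×_; _,_; proj₁; proj₂; map₂)
open import Data.Sum using (_⊎_; inj₁; inj₂)
open import Data.Vec using (Vec; []; _∷_; lookup; insertAt; removeAt)
open import Data.Vec.Properties using (≡-dec; insertAt-lookup; removeAt-insertAt; insertAt-removeAt)
open import Function.Base using (_∘_)
open import Function.Bundles using (_⇔_; mk⇔)
open import Relation.Binary.PropositionalEquality using (_≡_; _≢_; refl; sym; trans; cong; cong₂; subst)
open import Relation.Nullary using (Dec; yes; no; ¬_)
open import Relation.Nullary.Decidable using (⌊_⌋; isYes≗does; does-⇔; dec-false; ⌊⌋-map′; map′; _×-dec_; _⊎-dec_)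
open import Relation.Unary using (Decidable)

module PsiProperties {c ℓ : Level} (R : CommutativeRing c ℓ) (G : Graph) where
  open Chains R G
  open Graph G using (m; E; E-sym)
  open CommutativeRing R
    using (Carrier; _≈_; _+_; _*_; -_; 0#; 1#; setoid; ring; +-commutativeSemigroup;
           +-identityˡ; +-identityʳ; *-identityˡ; *-identityʳ; +-assoc; +-cong; +-congˡ; +-congʳ;
           *-comm; *-congˡ; -‿cong; -‿inverseʳ; zeroʳ; distribˡ)
    renaming (refl to ≈-refl; sym to ≈-sym; trans to ≈-trans; reflexive to ≈-reflexive)
  open RingProperties ring using (-‿+-comm; -0#≈0#; -‿distribʳ-*; -‿involutive)
  open CommutativeSemigroupProperties +-commutativeSemigroup using (interchange; x∙yz≈y∙xz)
  open import Relation.Binary.Reasoning.Setoid setoid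

  mask : Bool → Carrier → Carrier
  mask b r = if b then r else 0#

  mask-cong : ∀ b {r s} → r ≈ s → mask b r ≈ mask b s
  mask-cong true  r≈s = r≈s
  mask-cong false r≈s = ≈-refl

  mask-neg : ∀ b r → mask b (- r) ≈ - mask b r
  mask-neg true  r = ≈-refl
  mask-neg false r = ≈-sym -0#≈0#

  mask-cancel : ∀ b r → mask b r + mask b (- r) ≈ 0#
  mask-cancel true  r = -‿inverseʳ r
  mask-cancel false r = +-identityˡ 0#

  *-mask : ∀ b r s → r * mask b s ≈ s * mask b r
  *-mask true  r s = *-comm r s
  *-mask false r s = ≈-trans (zeroʳ r) (≈-sym (zeroʳ s))

  relabel : {X Y : Set} → (X → Y) → FS X → FS Y
  relabel f = map (map₂ f)

  negate : {X : Set} → FS X → FS X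
  negate = map (λ e → - proj₁ e , proj₂ e)

  negate-All : {X : Set} {P : X → Set} (xs : FS X) → All (λ e → P (proj₂ e)) xs → All (λ e → P (proj₂ e)) (negate xs)
  negate-All [] [] = []
  negate-All (_ ∷ xs) (p ∷ ps) = p ∷ negate-All xs ps

  module _ {X : Set} (eq : X → X → Bool) where

    coeff-∷ : ∀ r t xs x → coeff eq ((r , t) ∷ xs) x ≈ mask (eq t x) r + coeff eq xs x
    coeff-∷ r t xs x with eq t x
    ... | true  = ≈-refl
    ... | false = ≈-sym (+-identityˡ _)

    coeff-skip : ∀ {r t} xs {x} → eq t x ≡ false → coeff eq ((r , t) ∷ xs) x ≡ coeff eq xs x
    coeff-skip {t = t} xs {x} t≠x with eq t x
    coeff-skip xs refl | false = refl

    coeff-++ : ∀ xs ys x → coeff eq (xs ++ ys) x ≈ coeff eq xs x + coeff eq ys x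
    coeff-++ [] ys x = ≈-sym (+-identityˡ _)
    coeff-++ ((r , t) ∷ xs) ys x with eq t x
    ... | true  = ≈-trans (+-congˡ (coeff-++ xs ys x)) (≈-sym (+-assoc _ _ _))
    ... | false = coeff-++ xs ys x

    coeff-negate : ∀ xs x → coeff eq (negate xs) x ≈ - coeff eq xs x
    coeff-negate [] x = ≈-sym -0#≈0#
    coeff-negate ((r , t) ∷ xs) x with eq t x
    ... | true  = ≈-trans (+-congˡ (coeff-negate xs x)) (-‿+-comm _ _)
    ... | false = coeff-negate xs x

    coeff-miss : ∀ xs x → All (λ e → eq (proj₂ e) x ≡ false) xs → coeff eq xs x ≈ 0#
    coeff-miss [] x [] = ≈-refl
    coeff-miss (_ ∷ xs) x (t≠x ∷ h) = ≈-trans (≈-reflexive (coeff-skip xs t≠x)) (coeff-miss xs x h)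

    coeff-filter : ∀ {P : Carrier × X → Set} (P? : Decidable P) xs x →
                   All (λ e → ¬ P e → eq (proj₂ e) x ≡ false) xs →
                   coeff eq (filter P? xs) x ≈ coeff eq xs x
    coeff-filter P? [] x [] = ≈-refl
    coeff-filter P? ((r , t) ∷ xs) x (h ∷ hs) with P? (r , t)
    ... | yes _ = ≈-trans (coeff-∷ r t (filter P? xs) x) (≈-trans (+-congˡ (coeff-filter P? xs x hs)) (≈-sym (coeff-∷ r t xs x)))
    ... | no ¬p = ≈-trans (coeff-filter P? xs x hs) (≈-reflexive (sym (coeff-skip xs (h ¬p))))

    coeff-cancel : ∀ xs ys zs → xs ≈F[ eq ] (ys ++ zs) → ∀ x → coeff eq ys x ≈ coeff eq xs x + - coeff eq zs x
    coeff-cancel xs ys zs h x = begin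
      coeff eq ys x                                    ≈⟨ +-identityʳ _ ⟨
      coeff eq ys x + 0#                               ≈⟨ +-congˡ (-‿inverseʳ _) ⟨
      coeff eq ys x + (coeff eq zs x + - coeff eq zs x) ≈⟨ +-assoc _ _ _ ⟨
      (coeff eq ys x + coeff eq zs x) + - coeff eq zs x ≈⟨ +-congʳ (≈-trans (h x) (coeff-++ ys zs x)) ⟨
      coeff eq xs x + - coeff eq zs x                   ∎

  coeff-relabel : {X Y : Set} (eqX : X → X → Bool) (eqY : Y → Y → Bool) (f : X → Y) (xs : FS X) {x : X} {y : Y} →
                  All (λ e → eqY (f (proj₂ e)) y ≡ eqX (proj₂ e) x) xs →
                  coeff eqY (relabel f xs) y ≡ coeff eqX xs x
  coeff-relabel eqX eqY f [] [] = refl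
  coeff-relabel eqX eqY f ((r , t) ∷ xs) {x} {y} (h ∷ hs)
    rewrite h | coeff-relabel eqX eqY f xs hs = refl

  ⟪_∣_⟫ : {X : Set} → FS X → (X → Carrier) → Carrier
  ⟪ xs ∣ φ ⟫ = foldr (λ e acc → proj₁ e * φ (proj₂ e) + acc) 0# xs

  module _ {X : Set} where

    ⟪⟫-cong : ∀ (xs : FS X) {φ χ} → All (λ e → φ (proj₂ e) ≈ χ (proj₂ e)) xs → ⟪ xs ∣ φ ⟫ ≈ ⟪ xs ∣ χ ⟫
    ⟪⟫-cong [] [] = ≈-refl
    ⟪⟫-cong (_ ∷ xs) (h ∷ hs) = +-cong (*-congˡ h) (⟪⟫-cong xs hs)

    ⟪⟫-zero : ∀ (xs : FS X) → ⟪ xs ∣ (λ _ → 0#) ⟫ ≈ 0#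
    ⟪⟫-zero [] = ≈-refl
    ⟪⟫-zero ((r , _) ∷ xs) = ≈-trans (+-cong (zeroʳ r) (⟪⟫-zero xs)) (+-identityˡ 0#)

    ⟪⟫-+ : ∀ (xs : FS X) φ χ → ⟪ xs ∣ (λ x → φ x + χ x) ⟫ ≈ ⟪ xs ∣ φ ⟫ + ⟪ xs ∣ χ ⟫
    ⟪⟫-+ [] φ χ = ≈-sym (+-identityˡ 0#)
    ⟪⟫-+ ((r , x) ∷ xs) φ χ =
      ≈-trans (+-cong (distribˡ r (φ x) (χ x)) (⟪⟫-+ xs φ χ)) (interchange _ _ _ _)

    ⟪⟫-neg : ∀ (xs : FS X) φ → ⟪ xs ∣ (λ x → - φ x) ⟫ ≈ - ⟪ xs ∣ φ ⟫
    ⟪⟫-neg [] φ = ≈-sym -0#≈0#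
    ⟪⟫-neg ((r , x) ∷ xs) φ =
      ≈-trans (+-cong (≈-sym (-‿distribʳ-* r (φ x))) (⟪⟫-neg xs φ)) (-‿+-comm _ _)

    ⟪⟫-relabel : ∀ {Y : Set} (f : X → Y) (xs : FS X) φ → ⟪ relabel f xs ∣ φ ⟫ ≡ ⟪ xs ∣ (λ x → φ (f x)) ⟫
    ⟪⟫-relabel f [] φ = refl
    ⟪⟫-relabel f ((r , x) ∷ xs) φ = cong (r * φ (f x) +_) (⟪⟫-relabel f xs φ)

    module _ (eq : X → X → Bool) where

      coeff-⟪⟫ : ∀ xs x → coeff eq xs x ≈ ⟪ xs ∣ (λ x′ → mask (eq x′ x) 1#) ⟫
      coeff-⟪⟫ [] x = ≈-refl
      coeff-⟪⟫ ((r , t) ∷ xs) x = ≈-trans (coeff-∷ eq r t xs x) (+-cong (r≈ (eq t x)) (coeff-⟪⟫ xs x))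
        where
        r≈ : ∀ b → mask b r ≈ r * mask b 1#
        r≈ b = ≈-trans (≈-sym (*-identityˡ (mask b r))) (*-mask b 1# r)

      *-coeff : (∀ a b → eq a b ≡ eq b a) → ∀ r x L → r * coeff eq L x ≈ ⟪ L ∣ (λ x′ → mask (eq x x′) r) ⟫
      *-coeff eq-sym r x [] = zeroʳ r
      *-coeff eq-sym r x ((s , x′) ∷ L) = begin
        r * coeff eq ((s , x′) ∷ L) x                     ≈⟨ *-congˡ (coeff-∷ eq s x′ L x) ⟩
        r * (mask (eq x′ x) s + coeff eq L x)             ≈⟨ distribˡ r _ _ ⟩
        r * mask (eq x′ x) s + r * coeff eq L x           ≈⟨ +-cong (*-mask (eq x′ x) r s) (*-coeff eq-sym r x L) ⟩
        s * mask (eq x′ x) r + ⟪ L ∣ (λ x″ → mask (eq x x″) r) ⟫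
          ≈⟨ +-congʳ (*-congˡ (≈-reflexive (cong (λ b → mask b r) (eq-sym x′ x)))) ⟩
        s * mask (eq x x′) r + ⟪ L ∣ (λ x″ → mask (eq x x″) r) ⟫ ∎

      -- Both sides are Σ r s [x = x′] over (r , x) ∈ xs and (s , x′) ∈ L.
      ⟪⟫-exchange : (∀ a b → eq a b ≡ eq b a) → ∀ xs L → ⟪ xs ∣ coeff eq L ⟫ ≈ ⟪ L ∣ coeff eq xs ⟫
      ⟪⟫-exchange eq-sym [] L = ≈-sym (⟪⟫-zero L)
      ⟪⟫-exchange eq-sym ((r , x) ∷ xs) L = begin
        r * coeff eq L x + ⟪ xs ∣ coeff eq L ⟫
          ≈⟨ +-cong (*-coeff eq-sym r x L) (⟪⟫-exchange eq-sym xs L) ⟩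
        ⟪ L ∣ (λ x′ → mask (eq x x′) r) ⟫ + ⟪ L ∣ coeff eq xs ⟫
          ≈⟨ ⟪⟫-+ L _ _ ⟨
        ⟪ L ∣ (λ x′ → mask (eq x x′) r + coeff eq xs x′) ⟫
          ≈⟨ ⟪⟫-cong L (All.universal (λ e → coeff-∷ eq r x xs (proj₂ e)) L) ⟨
        ⟪ L ∣ coeff eq ((r , x) ∷ xs) ⟫ ∎

  -- ψ and ∂ are, definitionally, extend ψgen and extend ∂gen.
  extend : {X Y : Set} → (X → FS Y) → FS X → FS Y
  extend g = concatMap (λ p → map (λ q → proj₁ p * proj₁ q , proj₂ q) (g (proj₂ p)))

  module _ {Y : Set} (eq : Y → Y → Bool) where

    coeff-scale : ∀ r (ys : FS Y) y → coeff eq (map (λ q → r * proj₁ q , proj₂ q) ys) y ≈ r * coeff eq ys y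
    coeff-scale r [] y = ≈-sym (zeroʳ r)
    coeff-scale r ((s , t) ∷ ys) y with eq t y
    ... | true  = ≈-trans (+-congˡ (coeff-scale r ys y)) (≈-sym (distribˡ r s _))
    ... | false = coeff-scale r ys y

    coeff-extend : ∀ {X : Set} (g : X → FS Y) (xs : FS X) y →
                   coeff eq (extend g xs) y ≈ ⟪ xs ∣ (λ x → coeff eq (g x) y) ⟫
    coeff-extend g [] y = ≈-refl
    coeff-extend g ((r , x) ∷ xs) y =
      ≈-trans (coeff-++ eq (map (λ q → r * proj₁ q , proj₂ q) (g x)) (extend g xs) y)
              (+-cong (coeff-scale r (g x) y) (coeff-extend g xs y))

  ⌊⌋-⇔ : {A B : Set} → A ⇔ B → (a? : Dec A) (b? : Dec B) → ⌊ a? ⌋ ≡ ⌊ b? ⌋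
  ⌊⌋-⇔ A⇔B a? b? = trans (isYes≗does a?) (trans (does-⇔ A⇔B a? b?) (sym (isYes≗does b?)))

  ⌊⌋-× : {A B : Set} (a? : Dec A) (b? : Dec B) → ⌊ a? ×-dec b? ⌋ ≡ ⌊ a? ⌋ ∧ ⌊ b? ⌋
  ⌊⌋-× a? b? = trans (isYes≗does (a? ×-dec b?)) (sym (cong₂ _∧_ (isYes≗does a?) (isYes≗does b?)))

  eqVec-∷ : ∀ {k} a b (s t : Vec V k) → ⌊ ≡-dec _≟F_ (a ∷ s) (b ∷ t) ⌋ ≡ ⌊ a ≟F b ⌋ ∧ ⌊ ≡-dec _≟F_ s t ⌋
  eqVec-∷ a b s t = trans (⌊⌋-map′ _ _ ((a ≟F b) ×-dec ≡-dec _≟F_ s t)) (⌊⌋-× (a ≟F b) (≡-dec _≟F_ s t))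

  eqTup-false : ∀ {n} {s t : Tup n} → s ≢ t → eqTup s t ≡ false
  eqTup-false {s = s} {t} s≢t = trans (isYes≗does (≡-dec _≟F_ s t)) (dec-false (≡-dec _≟F_ s t) s≢t)

  eqTup-sym : ∀ {n} (s t : Tup n) → eqTup s t ≡ eqTup t s
  eqTup-sym s t = ⌊⌋-⇔ (mk⇔ sym sym) (≡-dec _≟F_ s t) (≡-dec _≟F_ t s)

  eqTup-insertAt : ∀ {n} (w : Tup n) i v (T : Tup (suc n)) →
                   eqTup (insertAt w i v) T ≡ ⌊ v ≟F lookup T i ⌋ ∧ eqTup (removeAt T i) w
  eqTup-insertAt w i v T =
    trans (⌊⌋-⇔ (mk⇔ to from) (≡-dec _≟F_ (insertAt w i v) T) ((v ≟F lookup T i) ×-dec ≡-dec _≟F_ (removeAt T i) w))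
          (⌊⌋-× (v ≟F lookup T i) (≡-dec _≟F_ (removeAt T i) w))
    where
    to : insertAt w i v ≡ T → v ≡ lookup T i × removeAt T i ≡ w
    to refl = sym (insertAt-lookup w i v) , removeAt-insertAt w i v
    from : v ≡ lookup T i × removeAt T i ≡ w → insertAt w i v ≡ T
    from (refl , refl) = insertAt-removeAt T i

  Near : V → V → Set
  Near x y = x ≡ y ⊎ Adj x y

  adj? : ∀ x y → Dec (Adj x y)
  adj? x y = E x y Bool.≟ true

  near? : ∀ x y → Dec (Near x y)
  near? x y = (x ≟F y) ⊎-dec adj? x y

  Near-sym : ∀ {x y} → Near x y → Near y x
  Near-sym (inj₁ x≡y) = inj₁ (sym x≡y)
  Near-sym {x} {y} (inj₂ xy) = inj₂ (trans (E-sym y x) xy)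

  record NearPath {n} (t : Tup n) : Set where
    constructor nearPath
    field step : ∀ (i : Fin n) → Near (lookup t (inject₁ i)) (lookup t (fsuc i))

  nearPath? : ∀ {n} (t : Tup n) → Dec (NearPath t)
  nearPath? t = map′ nearPath NearPath.step (all? (λ i → near? _ _))

  allowed⇒nearPath : ∀ {n} (t : Tup n) → Allowed t → NearPath t
  allowed⇒nearPath t al = nearPath (λ i → inj₂ (al i))

  -- u itself when u and w are near; otherwise a common neighbour (junk value u if there is none).
  midpoint : V → V → V
  midpoint u w with near? u w
  ... | yes _ = u
  ... | no _ with any? (λ x → adj? u x ×-dec adj? x w)
  ...   | yes (x , _) = x
  ...   | no _ = u

  midpoint-near : ∀ {u w} → Near u w → midpoint u w ≡ u
  midpoint-near {u} {w} uw with near? u w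
  ... | yes _ = refl
  ... | no ¬uw = ⊥-elim (¬uw uw)

  midpoint-between : ∀ {u v w} → Adj u v → Adj v w → Near u (midpoint u w) × Near (midpoint u w) w
  midpoint-between {u} {v} {w} uv vw with near? u w
  ... | yes uw = inj₁ refl , uw
  ... | no _ with any? (λ x → adj? u x ×-dec adj? x w)
  ...   | yes (x , ux , xw) = inj₂ ux , inj₂ xw
  ...   | no none = ⊥-elim (none (v , uv , vw))

  inTilde₀ : ∀ z → InTilde 0 z
  inTilde₀ z = z , All.universal (λ _ ()) z , [] , [] , λ t → ≈-sym (≈-trans (coeff-++ eqTup z [] t) (+-identityʳ _))

  inTilde-split : ∀ {n} (z : CV n) → All (λ e → Allowed (proj₂ e) ⊎ DegenerateTup (proj₂ e)) z → InTilde n z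
  inTilde-split [] [] = [] , [] , [] , [] , λ _ → ≈-refl
  inTilde-split ((r , t) ∷ z) (h ∷ hs) with inTilde-split z hs
  ... | a , aa , d , ad , z≈ with h
  ...   | inj₁ al = (r , t) ∷ a , al ∷ aa , d , ad , λ x →
          ≈-trans (coeff-∷ eqTup r t z x) (≈-trans (+-congˡ (z≈ x)) (≈-sym (coeff-∷ eqTup r t (a ++ d) x)))
  ...   | inj₂ dg = a , aa , (r , t) ∷ d , dg ∷ ad , λ x → begin
          coeff eqTup ((r , t) ∷ z) x                              ≈⟨ coeff-∷ eqTup r t z x ⟩
          mask (eqTup t x) r + coeff eqTup z x                     ≈⟨ +-congˡ (≈-trans (z≈ x) (coeff-++ eqTup a d x)) ⟩
          mask (eqTup t x) r + (coeff eqTup a x + coeff eqTup d x) ≈⟨ x∙yz≈y∙xz _ _ _ ⟩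
          coeff eqTup a x + (mask (eqTup t x) r + coeff eqTup d x) ≈⟨ +-congˡ (coeff-∷ eqTup r t d x) ⟨
          coeff eqTup a x + coeff eqTup ((r , t) ∷ d) x            ≈⟨ coeff-++ eqTup a ((r , t) ∷ d) x ⟨
          coeff eqTup (a ++ (r , t) ∷ d) x                         ∎

  inTilde-resp : ∀ {n} (z z′ : CV n) → z ≈F[ eqTup ] z′ → InTilde n z′ → InTilde n z
  inTilde-resp z z′ z≈z′ (a , aa , d , ad , z′≈) = a , aa , d , ad , λ t → ≈-trans (z≈z′ t) (z′≈ t)

  module LowDimension {n : ℕ}
    (corners             : Cube n → Tup n)
    (ψgen-corners        : ∀ σ → ψgen σ ≡ (1# , corners σ) ∷ [])
    (corners-reflects    : ∀ σ τ → eqTup (corners σ) (corners τ) ≡ eqCube σ τ)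
    (corners-nearPath    : ∀ σ → NearPath (corners σ))
    (fill                : Tup n → Cube n)
    (corners-fill        : ∀ {t : Tup n} → NearPath t → corners (fill t) ≡ t)
    (degenerate-corners  : ∀ σ → DegenerateCube σ → DegenerateTup (corners σ))
    (corners-degenerate  : ∀ σ → DegenerateTup (corners σ) → DegenerateCube σ)
    (degenerate-nearPath : ∀ (t : Tup n) → DegenerateTup t → NearPath t)
    (nearPath-split      : ∀ (t : Tup n) → NearPath t → Allowed t ⊎ DegenerateTup t)
    where

    ψ≈relabel : ∀ x → ψ x ≈F[ eqTup ] relabel corners x
    ψ≈relabel [] t = ≈-refl
    ψ≈relabel ((r , σ) ∷ x) t rewrite ψgen-corners σ = begin
      coeff eqTup ((r * 1# , corners σ) ∷ ψ x) t             ≈⟨ coeff-∷ eqTup _ _ (ψ x) t ⟩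
      mask (eqTup (corners σ) t) (r * 1#) + coeff eqTup (ψ x) t
        ≈⟨ +-cong (mask-cong (eqTup (corners σ) t) (*-identityʳ r)) (ψ≈relabel x t) ⟩
      mask (eqTup (corners σ) t) r + coeff eqTup (relabel corners x) t
        ≈⟨ coeff-∷ eqTup r (corners σ) (relabel corners x) t ⟨
      coeff eqTup ((r , corners σ) ∷ relabel corners x) t    ∎

    coeff-relabel-corners : ∀ x σ → coeff eqTup (relabel corners x) (corners σ) ≡ coeff eqCube x σ
    coeff-relabel-corners x σ = coeff-relabel eqCube eqTup corners x {σ} (All.universal (λ e → corners-reflects (proj₂ e) σ) x)

    coeff-relabel-fill : ∀ x {t} → NearPath t → coeff eqTup (relabel corners x) t ≡ coeff eqCube x (fill t)
    coeff-relabel-fill x {t} h = coeff-relabel eqCube eqTup corners x {fill t} (All.universal at-fill x)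
      where
      at-fill : ∀ e → eqTup (corners (proj₂ e)) t ≡ eqCube (proj₂ e) (fill t)
      at-fill e = trans (cong (eqTup (corners (proj₂ e))) (sym (corners-fill h))) (corners-reflects (proj₂ e) (fill t))

    coeff-relabel-¬nearPath : ∀ x {t} → ¬ NearPath t → coeff eqTup (relabel corners x) t ≈ 0#
    coeff-relabel-¬nearPath x {t} ¬h = coeff-miss eqTup (relabel corners x) t (map⁺ (All.universal miss x))
      where
      miss : ∀ e → eqTup (corners (proj₂ e)) t ≡ false
      miss e = eqTup-false λ c≡t → ¬h (subst NearPath c≡t (corners-nearPath (proj₂ e)))

    relabel-corners-cong : ∀ x y → x ≈F[ eqCube ] y → relabel corners x ≈F[ eqTup ] relabel corners y
    relabel-corners-cong x y x≈y t with nearPath? t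
    ... | yes h = ≈-trans (≈-reflexive (coeff-relabel-fill x h))
                    (≈-trans (x≈y (fill t)) (≈-reflexive (sym (coeff-relabel-fill y h))))
    ... | no ¬h = ≈-trans (coeff-relabel-¬nearPath x ¬h) (≈-sym (coeff-relabel-¬nearPath y ¬h))

    wellDefined : ∀ x y → x ~C y → ψ x ~P ψ y
    wellDefined x y (d , ad , x≈) = relabel corners d , map⁺ (All.map (λ {e} → degenerate-corners (proj₂ e)) ad) , λ t → begin
      coeff eqTup (ψ x) t                                            ≈⟨ ψ≈relabel x t ⟩
      coeff eqTup (relabel corners x) t                              ≈⟨ relabel-corners-cong x (y ++ d) x≈ t ⟩
      coeff eqTup (relabel corners (y ++ d)) t                       ≡⟨ cong (λ z → coeff eqTup z t) (map-++ (map₂ corners) y d) ⟩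
      coeff eqTup (relabel corners y ++ relabel corners d) t         ≈⟨ coeff-++ eqTup (relabel corners y) (relabel corners d) t ⟩
      coeff eqTup (relabel corners y) t + coeff eqTup (relabel corners d) t ≈⟨ +-congʳ (ψ≈relabel y t) ⟨
      coeff eqTup (ψ y) t + coeff eqTup (relabel corners d) t        ≈⟨ coeff-++ eqTup (ψ y) (relabel corners d) t ⟨
      coeff eqTup (ψ y ++ relabel corners d) t                       ∎

    ψ-inTilde : ∀ x → InTilde n (ψ x)
    ψ-inTilde x = inTilde-resp (ψ x) (relabel corners x) (ψ≈relabel x)
      (inTilde-split (relabel corners x) (map⁺ (All.universal (λ e → nearPath-split (corners (proj₂ e)) (corners-nearPath (proj₂ e))) x)))

    injective : Injective n
    injective x y (d , ad , ψx≈) = relabel fill d , map⁺ (All.map fill-degenerate ad) , λ σ → begin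
      coeff eqCube x σ                                       ≡⟨ coeff-relabel-corners x σ ⟨
      coeff eqTup (relabel corners x) (corners σ)            ≈⟨ ψ≈relabel x _ ⟨
      coeff eqTup (ψ x) (corners σ)                          ≈⟨ ψx≈ _ ⟩
      coeff eqTup (ψ y ++ d) (corners σ)                     ≈⟨ coeff-++ eqTup (ψ y) d _ ⟩
      coeff eqTup (ψ y) (corners σ) + coeff eqTup d (corners σ)
        ≈⟨ +-cong (≈-trans (ψ≈relabel y _) (≈-reflexive (coeff-relabel-corners y σ)))
                  (≈-reflexive (sym (coeff-relabel eqTup eqCube fill d {corners σ} {σ} (All.map (fill-reflects σ) ad)))) ⟩
      coeff eqCube y σ + coeff eqCube (relabel fill d) σ     ≈⟨ coeff-++ eqCube y (relabel fill d) σ ⟨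
      coeff eqCube (y ++ relabel fill d) σ                   ∎
      where
      fill-degenerate : ∀ {t} → DegenerateTup t → DegenerateCube (fill t)
      fill-degenerate {t} dg = corners-degenerate (fill t) (subst DegenerateTup (sym (corners-fill (degenerate-nearPath t dg))) dg)
      fill-reflects : ∀ σ {t} → DegenerateTup t → eqCube (fill t) σ ≡ eqTup t (corners σ)
      fill-reflects σ {t} dg = trans (sym (corners-reflects (fill t) σ)) (cong (λ s → eqTup s (corners σ)) (corners-fill (degenerate-nearPath t dg)))

    surjective : ∀ y → InTilde n y → Σ (CCube n) λ x → ψ x ~P y
    surjective y (a , aa , d , ad , y≈) = relabel fill a , negate d , negate-All d ad , λ t → begin
      coeff eqTup (ψ (relabel fill a)) t                  ≈⟨ ψ≈relabel (relabel fill a) t ⟩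
      coeff eqTup (relabel corners (relabel fill a)) t    ≡⟨ cong (λ z → coeff eqTup z t) (map-∘ {g = map₂ corners} {f = map₂ fill} a) ⟨
      coeff eqTup (relabel (λ s → corners (fill s)) a) t  ≡⟨ coeff-relabel eqTup eqTup (λ s → corners (fill s)) a (All.map (fill-corners t) aa) ⟩
      coeff eqTup a t                                     ≈⟨ coeff-cancel eqTup y a d y≈ t ⟩
      coeff eqTup y t + - coeff eqTup d t                 ≈⟨ +-congˡ (coeff-negate eqTup d t) ⟨
      coeff eqTup y t + coeff eqTup (negate d) t          ≈⟨ coeff-++ eqTup y (negate d) t ⟨
      coeff eqTup (y ++ negate d) t                       ∎
      where
      fill-corners : ∀ t {s} → Allowed s → eqTup (corners (fill s)) t ≡ eqTup s t
      fill-corners t {s} al = cong (λ s → eqTup s t) (corners-fill (allowed⇒nearPath s al))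

  point : V → Cube 0
  point v = record { fun = λ _ → v ; hom = λ { [] [] () } }

  corners₀ : Cube 0 → Tup 0
  corners₀ σ = fun σ [] ∷ []

  fill₀ : Tup 0 → Cube 0
  fill₀ (v ∷ []) = point v

  corners₀-reflects : ∀ σ τ → eqTup (corners₀ σ) (corners₀ τ) ≡ eqCube σ τ
  corners₀-reflects σ τ = eqVec-∷ (fun σ []) (fun τ []) [] []

  corners₀-fill₀ : ∀ {t : Tup 0} → NearPath t → corners₀ (fill₀ t) ≡ t
  corners₀-fill₀ {_ ∷ []} _ = refl

  module Dimension0 = LowDimension {0} corners₀ (λ _ → refl) corners₀-reflects (λ _ → nearPath (λ ())) fill₀
    corners₀-fill₀ (λ _ ()) (λ _ ()) (λ _ ()) (λ _ _ → inj₁ (λ ()))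

  iso₀ : IsIsomorphism 0
  iso₀ = (wellDefined , ψ-inTilde) , injective , surjective
    where open Dimension0

  segment : ∀ {p q} → Near p q → Cube 1
  segment {p} {q} pq = record { fun = f ; hom = f-near }
    where
    f : Vec Bool 1 → V
    f (false ∷ []) = p
    f (true  ∷ []) = q
    f-near : ∀ u v → HD1 u v → Near (f u) (f v)
    f-near (false ∷ []) (false ∷ []) _ = inj₁ refl
    f-near (false ∷ []) (true  ∷ []) _ = pq
    f-near (true  ∷ []) (false ∷ []) _ = Near-sym pq
    f-near (true  ∷ []) (true  ∷ []) _ = inj₁ refl

  corners₁ : Cube 1 → Tup 1
  corners₁ σ = fun σ (false ∷ []) ∷ fun σ (true ∷ []) ∷ []

  -- Junk value on tuples that are not near paths, which are never corners.
  fill₁ : Tup 1 → Cube 1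
  fill₁ (p ∷ q ∷ []) with near? p q
  ... | yes pq = segment pq
  ... | no _   = segment (inj₁ (refl {x = p}))

  corners₁-reflects : ∀ σ τ → eqTup (corners₁ σ) (corners₁ τ) ≡ eqCube σ τ
  corners₁-reflects σ τ =
    trans (eqVec-∷ a a′ (b ∷ []) (b′ ∷ []))
          (trans (cong (⌊ a ≟F a′ ⌋ ∧_) (eqVec-∷ b b′ [] [])) (∧-swap ⌊ a ≟F a′ ⌋ ⌊ b ≟F b′ ⌋ true))
    where
    a b a′ b′ : V
    a  = fun σ (false ∷ [])
    b  = fun σ (true ∷ [])
    a′ = fun τ (false ∷ [])
    b′ = fun τ (true ∷ [])
    ∧-swap : ∀ x y z → x ∧ (y ∧ z) ≡ y ∧ (x ∧ z)
    ∧-swap true  y     z = refl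
    ∧-swap false false z = refl
    ∧-swap false true  z = refl

  corners₁-nearPath : ∀ σ → NearPath (corners₁ σ)
  corners₁-nearPath σ = nearPath λ { fzero → hom σ (false ∷ []) (true ∷ []) (inj₂ ((λ ()) , refl)) }

  corners₁-fill₁ : ∀ {t : Tup 1} → NearPath t → corners₁ (fill₁ t) ≡ t
  corners₁-fill₁ {p ∷ q ∷ []} (nearPath h) with near? p q
  ... | yes _  = refl
  ... | no ¬pq = ⊥-elim (¬pq (h fzero))

  nearPath₁-split : ∀ (t : Tup 1) → NearPath t → Allowed t ⊎ DegenerateTup t
  nearPath₁-split (p ∷ q ∷ []) (nearPath h) with h fzero
  ... | inj₁ p≡q = inj₂ (fzero , p≡q)
  ... | inj₂ pq  = inj₁ λ { fzero → pq }

  degenerate-corners₁ : ∀ σ → DegenerateCube σ → DegenerateTup (corners₁ σ)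
  degenerate-corners₁ σ (fzero , e) = fzero , sym (e [])

  corners₁-degenerate : ∀ σ → DegenerateTup (corners₁ σ) → DegenerateCube σ
  corners₁-degenerate σ (fzero , e) = fzero , λ { [] → sym e }

  degenerate₁-nearPath : ∀ (t : Tup 1) → DegenerateTup t → NearPath t
  degenerate₁-nearPath (_ ∷ _ ∷ []) (fzero , e) = nearPath λ { fzero → inj₁ e }

  module Dimension1 = LowDimension {1} corners₁ (λ _ → refl) corners₁-reflects corners₁-nearPath fill₁ corners₁-fill₁
    degenerate-corners₁ corners₁-degenerate degenerate₁-nearPath nearPath₁-split

  iso₁ : IsIsomorphism 1
  iso₁ = (wellDefined , λ x → ψ-inTilde x , inTilde₀ (∂ (ψ x))) , injective , λ y → surjective y ∘ proj₁
    where open Dimension1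

  coeff-tabulate-unique : {X : Set} (eq : X → X → Bool) {k : ℕ} (r : Carrier) (F : Fin k → X) (x : X) (j : Fin k) (b : Bool) →
                          (∀ v → eq (F v) x ≡ ⌊ v ≟F j ⌋ ∧ b) → coeff eq (tabulate (λ v → r , F v)) x ≈ mask b r
  coeff-tabulate-unique eq r F x fzero b h = begin
    coeff eq (tabulate (λ v → r , F v)) x
      ≈⟨ coeff-∷ eq r (F fzero) (tabulate (λ v → r , F (fsuc v))) x ⟩
    mask (eq (F fzero) x) r + coeff eq (tabulate (λ v → r , F (fsuc v))) x
      ≈⟨ +-cong (≈-reflexive (cong (λ b′ → mask b′ r) (h fzero))) (coeff-miss eq _ x (tabulate⁺ (λ v → h (fsuc v)))) ⟩
    mask b r + 0#
      ≈⟨ +-identityʳ _ ⟩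
    mask b r ∎
  coeff-tabulate-unique eq r F x (fsuc j) b h =
    ≈-trans (≈-reflexive (coeff-skip eq (tabulate (λ v → r , F (fsuc v))) (h fzero)))
            (coeff-tabulate-unique eq r (F ∘ fsuc) x j b λ v → trans (h (fsuc v)) (cong (_∧ b) (⌊⌋-map′ _ _ (v ≟F j))))

  boundaryDual : ∀ {n} → Tup n → CV (suc n)
  boundaryDual {n} w = concatMap (λ i → tabulate (λ v → alt (toℕ i) 1# , insertAt w i v)) (allFin (suc (suc n)))

  coeff-∂gen-dual : ∀ {n} (T : Tup (suc n)) (w : Tup n) → coeff eqTup (∂gen T) w ≈ coeff eqTup (boundaryDual w) T
  coeff-∂gen-dual {n} T w = faces (allFin (suc (suc n)))
    where
    sign : Fin (suc (suc n)) → Carrier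
    sign i = alt (toℕ i) 1#
    cofaces : Fin (suc (suc n)) → CV (suc n)
    cofaces i = tabulate (λ v → sign i , insertAt w i v)
    faces : ∀ is → coeff eqTup (map (λ i → sign i , removeAt T i) is) w ≈ coeff eqTup (concatMap cofaces is) T
    faces [] = ≈-refl
    faces (i ∷ is) = begin
      coeff eqTup ((sign i , removeAt T i) ∷ map (λ i → sign i , removeAt T i) is) w
        ≈⟨ coeff-∷ eqTup (sign i) (removeAt T i) (map (λ i → sign i , removeAt T i) is) w ⟩
      mask (eqTup (removeAt T i) w) (sign i) + coeff eqTup (map (λ i → sign i , removeAt T i) is) w
        ≈⟨ +-cong (≈-sym (coeff-tabulate-unique eqTup (sign i) (insertAt w i) T (lookup T i) _ (λ v → eqTup-insertAt w i v T)))
                  (faces is) ⟩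
      coeff eqTup (cofaces i) T + coeff eqTup (concatMap cofaces is) T
        ≈⟨ coeff-++ eqTup (cofaces i) (concatMap cofaces is) T ⟨
      coeff eqTup (cofaces i ++ concatMap cofaces is) T ∎

  coeff-∂ : ∀ {n} (z : CV (suc n)) w → coeff eqTup (∂ z) w ≈ ⟪ boundaryDual w ∣ coeff eqTup z ⟫
  coeff-∂ z w = begin
    coeff eqTup (∂ z) w                           ≈⟨ coeff-extend eqTup ∂gen z w ⟩
    ⟪ z ∣ (λ T → coeff eqTup (∂gen T) w) ⟫        ≈⟨ ⟪⟫-cong z (All.universal (λ e → coeff-∂gen-dual (proj₂ e) w) z) ⟩
    ⟪ z ∣ coeff eqTup (boundaryDual w) ⟫          ≈⟨ ⟪⟫-exchange eqTup eqTup-sym z (boundaryDual w) ⟩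
    ⟪ boundaryDual w ∣ coeff eqTup z ⟫            ∎

  coeff-∂-++ : ∀ {n} (z a d : CV (suc n)) → z ≈F[ eqTup ] (a ++ d) → ∀ w →
               coeff eqTup (∂ z) w ≈ coeff eqTup (∂ a) w + coeff eqTup (∂ d) w
  coeff-∂-++ {n} z a d z≈ w = begin
    coeff eqTup (∂ z) w                                       ≈⟨ coeff-∂ z w ⟩
    ⟪ D ∣ coeff eqTup z ⟫                                     ≈⟨ ⟪⟫-cong D (All.universal (λ e → ≈-trans (z≈ (proj₂ e)) (coeff-++ eqTup a d (proj₂ e))) D) ⟩
    ⟪ D ∣ (λ T → coeff eqTup a T + coeff eqTup d T) ⟫         ≈⟨ ⟪⟫-+ D (coeff eqTup a) (coeff eqTup d) ⟩
    ⟪ D ∣ coeff eqTup a ⟫ + ⟪ D ∣ coeff eqTup d ⟫             ≈⟨ +-cong (coeff-∂ a w) (coeff-∂ d w) ⟨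
    coeff eqTup (∂ a) w + coeff eqTup (∂ d) w                 ∎
    where
    D : CV (suc n)
    D = boundaryDual w

  square : ∀ {a b c d} → Near a b → Near a c → Near b d → Near c d → Cube 2
  square {a} {b} {c} {d} ab ac bd cd = record { fun = f ; hom = f-near }
    where
    f : Vec Bool 2 → V
    f (false ∷ false ∷ []) = a
    f (true  ∷ false ∷ []) = b
    f (false ∷ true  ∷ []) = c
    f (true  ∷ true  ∷ []) = d
    f-near : ∀ u v → HD1 u v → Near (f u) (f v)
    f-near (false ∷ false ∷ []) (false ∷ false ∷ []) _ = inj₁ refl
    f-near (false ∷ false ∷ []) (true  ∷ false ∷ []) _ = ab
    f-near (false ∷ false ∷ []) (false ∷ true  ∷ []) _ = ac
    f-near (false ∷ false ∷ []) (true  ∷ true  ∷ []) (inj₁ (() , _))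
    f-near (false ∷ false ∷ []) (true  ∷ true  ∷ []) (inj₂ (_ , ()))
    f-near (true  ∷ false ∷ []) (false ∷ false ∷ []) _ = Near-sym ab
    f-near (true  ∷ false ∷ []) (true  ∷ false ∷ []) _ = inj₁ refl
    f-near (true  ∷ false ∷ []) (false ∷ true  ∷ []) (inj₁ (() , _))
    f-near (true  ∷ false ∷ []) (false ∷ true  ∷ []) (inj₂ (_ , ()))
    f-near (true  ∷ false ∷ []) (true  ∷ true  ∷ []) _ = bd
    f-near (false ∷ true  ∷ []) (false ∷ false ∷ []) _ = Near-sym ac
    f-near (false ∷ true  ∷ []) (true  ∷ false ∷ []) (inj₁ (() , _))
    f-near (false ∷ true  ∷ []) (true  ∷ false ∷ []) (inj₂ (_ , ()))
    f-near (false ∷ true  ∷ []) (false ∷ true  ∷ []) _ = inj₁ refl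
    f-near (false ∷ true  ∷ []) (true  ∷ true  ∷ []) _ = cd
    f-near (true  ∷ true  ∷ []) (false ∷ false ∷ []) (inj₁ (() , _))
    f-near (true  ∷ true  ∷ []) (false ∷ false ∷ []) (inj₂ (_ , ()))
    f-near (true  ∷ true  ∷ []) (true  ∷ false ∷ []) _ = Near-sym bd
    f-near (true  ∷ true  ∷ []) (false ∷ true  ∷ []) _ = Near-sym cd
    f-near (true  ∷ true  ∷ []) (true  ∷ true  ∷ []) _ = inj₁ refl

  shortcut : Tup 2 → Tup 2
  shortcut (u ∷ _ ∷ w ∷ []) = u ∷ midpoint u w ∷ w ∷ []

  ends : Tup 2 → Tup 1
  ends (u ∷ _ ∷ w ∷ []) = u ∷ w ∷ []

  NearEnds : Tup 2 → Set
  NearEnds (u ∷ _ ∷ w ∷ []) = Near u w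

  nearEnds? : ∀ t → Dec (NearEnds t)
  nearEnds? (u ∷ _ ∷ w ∷ []) = near? u w

  -- The square u → v → w, u → midpoint u w → w; its ψ is (u, v, w) − shortcut (u, v, w).
  filler : (T : Tup 2) → Allowed T → Cube 2
  filler (u ∷ v ∷ w ∷ []) al = square (inj₂ (al fzero)) (proj₁ between) (inj₂ (al (fsuc fzero))) (proj₂ between)
    where
    between : Near u (midpoint u w) × Near (midpoint u w) w
    between = midpoint-between (al fzero) (al (fsuc fzero))

  fillers : (a : CV 2) → All (λ e → Allowed (proj₂ e)) a → CCube 2
  fillers [] [] = []
  fillers ((r , T) ∷ a) (al ∷ aa) = (r , filler T al) ∷ fillers a aa

  +-neg-interchange : ∀ a b c d → a + (- b + (c + - d)) ≈ (a + c) + - (b + d)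
  +-neg-interchange a b c d = begin
    a + (- b + (c + - d))     ≈⟨ +-assoc a (- b) (c + - d) ⟨
    (a + - b) + (c + - d)     ≈⟨ interchange a (- b) c (- d) ⟩
    (a + c) + (- b + - d)     ≈⟨ +-congˡ (-‿+-comm b d) ⟩
    (a + c) + - (b + d)       ∎

  coeff-ψ-fillers : ∀ a aa t → coeff eqTup (ψ (fillers a aa)) t ≈ coeff eqTup a t + - coeff eqTup (relabel shortcut a) t
  coeff-ψ-fillers [] [] t = ≈-sym (≈-trans (+-congˡ -0#≈0#) (+-identityʳ 0#))
  coeff-ψ-fillers ((r , T@(u ∷ v ∷ w ∷ [])) ∷ a) (al ∷ aa) t = begin
    coeff eqTup ((r * 1# , T) ∷ (r * - 1# , shortcut T) ∷ ψ (fillers a aa)) t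
      ≈⟨ ≈-trans (coeff-∷ eqTup (r * 1#) T ((r * - 1# , shortcut T) ∷ ψ (fillers a aa)) t)
                 (+-congˡ (coeff-∷ eqTup (r * - 1#) (shortcut T) (ψ (fillers a aa)) t)) ⟩
    mask (eqTup T t) (r * 1#) + (mask (eqTup (shortcut T) t) (r * - 1#) + coeff eqTup (ψ (fillers a aa)) t)
      ≈⟨ +-cong (mask-cong (eqTup T t) (*-identityʳ r))
                (+-cong (≈-trans (mask-cong (eqTup (shortcut T) t) r*-1≈-r) (mask-neg (eqTup (shortcut T) t) r))
                        (coeff-ψ-fillers a aa t)) ⟩
    mask (eqTup T t) r + (- mask (eqTup (shortcut T) t) r + (coeff eqTup a t + - coeff eqTup (relabel shortcut a) t))
      ≈⟨ +-neg-interchange _ _ _ _ ⟩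
    (mask (eqTup T t) r + coeff eqTup a t) + - (mask (eqTup (shortcut T) t) r + coeff eqTup (relabel shortcut a) t)
      ≈⟨ +-cong (coeff-∷ eqTup r T a t) (-‿cong (coeff-∷ eqTup r (shortcut T) (relabel shortcut a) t)) ⟨
    coeff eqTup ((r , T) ∷ a) t + - coeff eqTup ((r , shortcut T) ∷ relabel shortcut a) t ∎
    where
    r*-1≈-r : r * - 1# ≈ - r
    r*-1≈-r = ≈-trans (≈-sym (-‿distribʳ-* r 1#)) (-‿cong (*-identityʳ r))

  coeff-∂gen₂ : ∀ x y z w → coeff eqTup (∂gen (x ∷ y ∷ z ∷ [])) w ≈
                mask (eqTup (y ∷ z ∷ []) w) 1# + (mask (eqTup (x ∷ z ∷ []) w) (- 1#) + mask (eqTup (x ∷ y ∷ []) w) (- (- 1#)))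
  coeff-∂gen₂ x y z w =
    ≈-trans (coeff-∷ eqTup 1# (y ∷ z ∷ []) ((- 1# , x ∷ z ∷ []) ∷ (- (- 1#) , x ∷ y ∷ []) ∷ []) w) (+-congˡ
      (≈-trans (coeff-∷ eqTup (- 1#) (x ∷ z ∷ []) ((- (- 1#) , x ∷ y ∷ []) ∷ []) w) (+-congˡ
        (≈-trans (coeff-∷ eqTup (- (- 1#)) (x ∷ y ∷ []) [] w) (+-identityʳ _)))))

  module _ {p s : V} (far : ¬ Near p s) where

    edge-not-far : ∀ {x y} → Adj x y → eqTup (x ∷ y ∷ []) (p ∷ s ∷ []) ≡ false
    edge-not-far xy = eqTup-false λ { refl → far (inj₂ xy) }

    loop-not-far : ∀ x → eqTup (x ∷ x ∷ []) (p ∷ s ∷ []) ≡ false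
    loop-not-far x = eqTup-false λ { refl → far (inj₁ refl) }

    coeff-∂gen-degenerate : ∀ T → DegenerateTup T → coeff eqTup (∂gen T) (p ∷ s ∷ []) ≈ 0#
    coeff-∂gen-degenerate (x ∷ .x ∷ z ∷ []) (fzero , refl) =
      ≈-trans (coeff-∂gen₂ x x z (p ∷ s ∷ []))
        (≈-trans (+-congˡ (≈-trans (+-congˡ (≈-reflexive (cong (λ b → mask b (- (- 1#))) (loop-not-far x)))) (+-identityʳ _)))
                 (mask-cancel _ 1#))
    coeff-∂gen-degenerate (x ∷ z ∷ .z ∷ []) (fsuc fzero , refl) =
      ≈-trans (coeff-∂gen₂ x z z (p ∷ s ∷ []))
        (≈-trans (+-congʳ (≈-reflexive (cong (λ b → mask b 1#) (loop-not-far z))))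
                 (≈-trans (+-identityˡ _) (mask-cancel _ (- 1#))))

    coeff-∂gen-allowed : ∀ T → Allowed T → coeff eqTup (∂gen T) (p ∷ s ∷ []) ≈ - mask (eqTup (ends T) (p ∷ s ∷ [])) 1#
    coeff-∂gen-allowed (u ∷ v ∷ w ∷ []) al = begin
      coeff eqTup (∂gen (u ∷ v ∷ w ∷ [])) (p ∷ s ∷ [])
        ≈⟨ coeff-∂gen₂ u v w (p ∷ s ∷ []) ⟩
      mask (eqTup (v ∷ w ∷ []) (p ∷ s ∷ [])) 1# + (mask b (- 1#) + mask (eqTup (u ∷ v ∷ []) (p ∷ s ∷ [])) (- (- 1#)))
        ≈⟨ ≈-reflexive (cong₂ (λ b₀ b₂ → mask b₀ 1# + (mask b (- 1#) + mask b₂ (- (- 1#))))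
                              (edge-not-far (al (fsuc fzero))) (edge-not-far (al fzero))) ⟩
      0# + (mask b (- 1#) + 0#)
        ≈⟨ ≈-trans (+-identityˡ _) (+-identityʳ _) ⟩
      mask b (- 1#)
        ≈⟨ mask-neg b 1# ⟩
      - mask b 1# ∎
      where
      b : Bool
      b = eqTup (u ∷ w ∷ []) (p ∷ s ∷ [])

    inTilde₁-far : ∀ z → InTilde 1 z → coeff eqTup z (p ∷ s ∷ []) ≈ 0#
    inTilde₁-far z (b , ab , d , ad , z≈) = begin
      coeff eqTup z (p ∷ s ∷ [])                             ≈⟨ z≈ _ ⟩
      coeff eqTup (b ++ d) (p ∷ s ∷ [])                      ≈⟨ coeff-++ eqTup b d _ ⟩
      coeff eqTup b (p ∷ s ∷ []) + coeff eqTup d (p ∷ s ∷ []) ≈⟨ +-cong (coeff-miss eqTup b _ (All.map (λ {e} → edge {e}) ab))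
                                                                      (coeff-miss eqTup d _ (All.map (λ {e} → loop {e}) ad)) ⟩
      0# + 0#                                                ≈⟨ +-identityʳ 0# ⟩
      0#                                                     ∎
      where
      edge : ∀ {e : Carrier × Tup 1} → Allowed (proj₂ e) → eqTup (proj₂ e) (p ∷ s ∷ []) ≡ false
      edge {_ , _ ∷ _ ∷ []} al = edge-not-far (al fzero)
      loop : ∀ {e : Carrier × Tup 1} → DegenerateTup (proj₂ e) → eqTup (proj₂ e) (p ∷ s ∷ []) ≡ false
      loop {_ , x ∷ .x ∷ []} (fzero , refl) = loop-not-far x

    coeff-∂-degenerate : ∀ d → All (λ e → DegenerateTup (proj₂ e)) d → coeff eqTup (∂ d) (p ∷ s ∷ []) ≈ 0#
    coeff-∂-degenerate d ad =
      ≈-trans (coeff-extend eqTup ∂gen d _)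
        (≈-trans (⟪⟫-cong d (All.map (λ {e} → coeff-∂gen-degenerate (proj₂ e)) ad)) (⟪⟫-zero d))

    coeff-∂-allowed : ∀ a → All (λ e → Allowed (proj₂ e)) a →
                      coeff eqTup (∂ a) (p ∷ s ∷ []) ≈ - coeff eqTup (relabel ends a) (p ∷ s ∷ [])
    coeff-∂-allowed a aa = begin
      coeff eqTup (∂ a) (p ∷ s ∷ [])                          ≈⟨ coeff-extend eqTup ∂gen a _ ⟩
      ⟪ a ∣ (λ T → coeff eqTup (∂gen T) (p ∷ s ∷ [])) ⟫       ≈⟨ ⟪⟫-cong a (All.map (λ {e} → coeff-∂gen-allowed (proj₂ e)) aa) ⟩
      ⟪ a ∣ (λ T → - mask (eqTup (ends T) (p ∷ s ∷ [])) 1#) ⟫ ≈⟨ ⟪⟫-neg a _ ⟩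
      - ⟪ a ∣ (λ T → mask (eqTup (ends T) (p ∷ s ∷ [])) 1#) ⟫ ≡⟨ cong -_ (⟪⟫-relabel ends a _) ⟨
      - ⟪ relabel ends a ∣ (λ t → mask (eqTup t (p ∷ s ∷ [])) 1#) ⟫ ≈⟨ -‿cong (coeff-⟪⟫ eqTup (relabel ends a) _) ⟨
      - coeff eqTup (relabel ends a) (p ∷ s ∷ [])             ∎

  shortcut-idem : ∀ T → shortcut (shortcut T) ≡ shortcut T
  shortcut-idem (_ ∷ _ ∷ _ ∷ []) = refl

  shortcut-degenerate : ∀ T → NearEnds (shortcut T) → DegenerateTup (shortcut T)
  shortcut-degenerate (_ ∷ _ ∷ _ ∷ []) uw = fzero , sym (midpoint-near uw)

  eqTup-shortcut : ∀ T t → eqTup (shortcut T) (shortcut t) ≡ eqTup (ends T) (ends t)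
  eqTup-shortcut T@(_ ∷ _ ∷ _ ∷ []) t@(_ ∷ _ ∷ _ ∷ []) =
    ⌊⌋-⇔ (mk⇔ (cong ends) λ { refl → refl }) (≡-dec _≟F_ (shortcut T) (shortcut t)) (≡-dec _≟F_ (ends T) (ends t))

  coeff-shortcuts-far : ∀ a → (∀ {p s} → ¬ Near p s → coeff eqTup (relabel ends a) (p ∷ s ∷ []) ≈ 0#) →
                        ∀ t → ¬ NearEnds t → coeff eqTup (relabel shortcut a) t ≈ 0#
  coeff-shortcuts-far a ends-far t@(u ∷ _ ∷ w ∷ []) far with ≡-dec _≟F_ (shortcut t) t
  ... | yes t-shortcut = begin
    coeff eqTup (relabel shortcut a) t               ≡⟨ cong (coeff eqTup (relabel shortcut a)) t-shortcut ⟨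
    coeff eqTup (relabel shortcut a) (shortcut t)    ≡⟨ coeff-relabel eqEnds eqTup shortcut a {t} (All.universal (λ e → eqTup-shortcut (proj₂ e) t) a) ⟩
    coeff eqEnds a t                                 ≡⟨ coeff-relabel eqEnds eqTup ends a {t} (All.universal (λ _ → refl) a) ⟨
    coeff eqTup (relabel ends a) (u ∷ w ∷ [])        ≈⟨ ends-far far ⟩
    0#                                               ∎
    where
    eqEnds : Tup 2 → Tup 2 → Bool
    eqEnds T T′ = eqTup (ends T) (ends T′)
  ... | no ¬t-shortcut = coeff-miss eqTup (relabel shortcut a) t (map⁺ (All.universal miss a))
    where
    miss : ∀ e → eqTup (shortcut (proj₂ e)) t ≡ false
    miss e = eqTup-false λ hit → ¬t-shortcut (trans (cong shortcut (sym hit)) (trans (shortcut-idem (proj₂ e)) hit))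

  nearShortcuts : CV 2 → CV 2
  nearShortcuts a = filter (λ e → nearEnds? (proj₂ e)) (relabel shortcut a)

  nearShortcuts-degenerate : ∀ a → All (λ e → DegenerateTup (proj₂ e)) (nearShortcuts a)
  nearShortcuts-degenerate a =
    All.zipWith (λ (degenerate-if-near , near) → degenerate-if-near near)
      (filter⁺ _ (map⁺ {P = λ e → NearEnds (proj₂ e) → DegenerateTup (proj₂ e)} (All.universal (λ e → shortcut-degenerate (proj₂ e)) a)) , all-filter _ (relabel shortcut a))

  coeff-nearShortcuts : ∀ a → (∀ {p s} → ¬ Near p s → coeff eqTup (relabel ends a) (p ∷ s ∷ []) ≈ 0#) →
                        relabel shortcut a ≈F[ eqTup ] nearShortcuts a
  coeff-nearShortcuts a ends-far t with nearEnds? t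
  ... | yes near = ≈-sym (coeff-filter eqTup _ (relabel shortcut a) t (All.universal miss (relabel shortcut a)))
    where
    miss : ∀ e → ¬ NearEnds (proj₂ e) → eqTup (proj₂ e) t ≡ false
    miss e far = eqTup-false λ { refl → far near }
  ... | no far = ≈-trans (coeff-shortcuts-far a ends-far t far)
                         (≈-sym (coeff-miss eqTup (nearShortcuts a) t (All.map (λ {e} → miss e) (all-filter _ (relabel shortcut a)))))
    where
    miss : ∀ e → NearEnds (proj₂ e) → eqTup (proj₂ e) t ≡ false
    miss e near = eqTup-false λ { refl → far near }

  surjective₂ : Surjective 2
  surjective₂ y ((a , aa , d , ad , y≈) , ∂y∈C̃) =
    fillers a aa , negate d ++ negate (nearShortcuts a) ,
    ++⁺ (negate-All d ad) (negate-All (nearShortcuts a) (nearShortcuts-degenerate a)) , λ t → begin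
      coeff eqTup (ψ (fillers a aa)) t
        ≈⟨ coeff-ψ-fillers a aa t ⟩
      coeff eqTup a t + - coeff eqTup (relabel shortcut a) t
        ≈⟨ +-cong (coeff-cancel eqTup y a d y≈ t) (-‿cong (coeff-nearShortcuts a ends-far t)) ⟩
      (coeff eqTup y t + - coeff eqTup d t) + - coeff eqTup (nearShortcuts a) t
        ≈⟨ +-assoc _ _ _ ⟩
      coeff eqTup y t + (- coeff eqTup d t + - coeff eqTup (nearShortcuts a) t)
        ≈⟨ +-congˡ (+-cong (coeff-negate eqTup d t) (coeff-negate eqTup (nearShortcuts a) t)) ⟨
      coeff eqTup y t + (coeff eqTup (negate d) t + coeff eqTup (negate (nearShortcuts a)) t)
        ≈⟨ +-congˡ (coeff-++ eqTup (negate d) (negate (nearShortcuts a)) t) ⟨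
      coeff eqTup y t + coeff eqTup (negate d ++ negate (nearShortcuts a)) t
        ≈⟨ coeff-++ eqTup y (negate d ++ negate (nearShortcuts a)) t ⟨
      coeff eqTup (y ++ negate d ++ negate (nearShortcuts a)) t ∎
    where
    ∂a-far : ∀ {p s} → ¬ Near p s → coeff eqTup (∂ a) (p ∷ s ∷ []) ≈ 0#
    ∂a-far {p} {s} far = begin
      coeff eqTup (∂ a) (p ∷ s ∷ [])                                 ≈⟨ +-identityʳ _ ⟨
      coeff eqTup (∂ a) (p ∷ s ∷ []) + 0#                            ≈⟨ +-congˡ (coeff-∂-degenerate far d ad) ⟨
      coeff eqTup (∂ a) (p ∷ s ∷ []) + coeff eqTup (∂ d) (p ∷ s ∷ []) ≈⟨ coeff-∂-++ y a d y≈ (p ∷ s ∷ []) ⟨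
      coeff eqTup (∂ y) (p ∷ s ∷ [])                                 ≈⟨ inTilde₁-far far (∂ y) ∂y∈C̃ ⟩
      0#                                                             ∎
    ends-far : ∀ {p s} → ¬ Near p s → coeff eqTup (relabel ends a) (p ∷ s ∷ []) ≈ 0#
    ends-far {p} {s} far = begin
      coeff eqTup (relabel ends a) (p ∷ s ∷ [])         ≈⟨ -‿involutive _ ⟨
      - (- coeff eqTup (relabel ends a) (p ∷ s ∷ []))   ≈⟨ -‿cong (coeff-∂-allowed far a aa) ⟨
      - coeff eqTup (∂ a) (p ∷ s ∷ [])                  ≈⟨ -‿cong (∂a-far far) ⟩
      - 0#                                              ≈⟨ -0#≈0# ⟩
      0#                                                ∎

lemma5p3 : ∀ {c ℓ : Level} (R : CommutativeRing c ℓ) (G : Graph) →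
    (∀ (n : ℕ) → n ≤ 1 → Chains.IsIsomorphism R G n) × Chains.Surjective R G 2
lemma5p3 R G = isomorphism , surjective₂
  where
  open PsiProperties R G
  isomorphism : ∀ n → n ≤ 1 → Chains.IsIsomorphism R G n
  isomorphism zero          _         = iso₀
  isomorphism (suc zero)    _         = iso₁
  isomorphism (suc (suc n)) (s≤s ())
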